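{- Let $G=(V,E)$ be a finite multigraph in which each edge carries its own label, and let $\omega$ and $u_e$ ($e\in E$) be variables. The chain polynomial $Ch(G,\omega,\bar u)=\sum_{S\subseteq E}(1-\omega)^{|S|-r(S)}\prod_{e\in E\setminus S}u_e$ satisfies $$Ch(G,\omega,\bar u)=\Big(\prod_{e\in E}u_e\Big)(1-\omega)^{ -|V|}\,\xi_{lab}(G,1-\omega,1,0,\bar v),\qquad v_e=\frac{1-\omega}{u_e}.$$
   Context: For $S\subseteq E$, $k(S)$ is the number of connected components of $(V,S)$, $r(S)=|V|-k(S)$, $V(S)$ the set of vertices covered by $S$, and $k_{cov}(B)$ the number of connected components of $(V(B),B)$. With an indeterminate $t_e$ for each edge $e$, $\xi_{lab}(G,x,y,z,\bar t)=\sum_{(A,B)} x^{k(A\cup B)}\big(\prod_{e\in A\cup B} y\,t_{e}\big)\big(\tfrac{z}{xy}\big)^{k_{cov}(B)}$, summing over pairs $A,B\subseteq E$ with $V(A)\cap V(B)=\emptyset$; this is a polynomial, and $0^0=1$. -}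

module Defs where

open import Data.Nat using (ℕ; zero; suc; _∸_)
open import Data.Bool using (Bool; true; false; _∧_; _∨_; not; if_then_else_)
open import Data.Fin using (Fin; zero; suc; toℕ; _≟_)
open import Data.Vec using (Vec; []; _∷_; lookup; zipWith)
open import Data.List using (List; []; _∷_; _++_; map; concatMap; foldr)
open import Data.Product using (_×_; _,_; proj₁; proj₂)
open import Relation.Nullary.Decidable using (⌊_⌋)
open import Algebra.Bundles using (CommutativeRing)

-- Vertices are Fin n, edges are Fin m (each edge is its own label);
-- every edge has two (not necessarily distinct) endpoints, so loops and
-- parallel edges are allowed.

record Multigraph : Set where
  field
    n    : ℕ
    m    : ℕ
    ends : Fin m → Fin n × Fin n
open Multigraph public

anyFin : (k : ℕ) → (Fin k → Bool) → Bool
anyFin zero    f = false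
anyFin (suc k) f = f zero ∨ anyFin k (λ i → f (suc i))

allFin : (k : ℕ) → (Fin k → Bool) → Bool
allFin k f = not (anyFin k (λ i → not (f i)))

countFin : (k : ℕ) → (Fin k → Bool) → ℕ
countFin zero    f = zero
countFin (suc k) f = (if f zero then 1 else 0) + countFin k (λ i → f (suc i))
  where open Data.Nat using (_+_)

-- all subsets of Fin k, as characteristic vectors
subsets : (k : ℕ) → List (Vec Bool k)
subsets zero    = [] ∷ []
subsets (suc k) = map (true ∷_) (subsets k) ++ map (false ∷_) (subsets k)

EdgeSet : Multigraph → Set
EdgeSet G = Vec Bool (m G)

_∈ₑ_ : {j : ℕ} → Fin j → Vec Bool j → Bool
e ∈ₑ S = lookup S e

_∪ₑ_ : {j : ℕ} → Vec Bool j → Vec Bool j → Vec Bool j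
A ∪ₑ B = zipWith _∨_ A B

size : (G : Multigraph) → EdgeSet G → ℕ
size G S = countFin (m G) (λ e → e ∈ₑ S)

_==_ : {k : ℕ} → Fin k → Fin k → Bool
a == b = ⌊ a ≟ b ⌋

reach : (G : Multigraph) → EdgeSet G → ℕ → Fin (n G) → Fin (n G) → Bool
reach G S zero    u v = u == v
reach G S (suc j) u v =
  reach G S j u v ∨
  anyFin (m G) (λ e → (e ∈ₑ S) ∧
    ((reach G S j u (proj₁ (ends G e)) ∧ (proj₂ (ends G e) == v)) ∨
     (reach G S j u (proj₂ (ends G e)) ∧ (proj₁ (ends G e) == v))))

-- u and v lie in the same connected component of (V,S)
-- (a walk with at most |V| edges exists iff a walk exists)
connected : (G : Multigraph) → EdgeSet G → Fin (n G) → Fin (n G) → Bool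
connected G S u v = reach G S (n G) u v

isRep : (G : Multigraph) → EdgeSet G → Fin (n G) → Bool
isRep G S v = allFin (n G) (λ w → not (⌊ toℕ w Data.Nat.<? toℕ v ⌋ ∧ connected G S w v))

-- k(S): number of connected components of (V,S)
k : (G : Multigraph) → EdgeSet G → ℕ
k G S = countFin (n G) (isRep G S)

r : (G : Multigraph) → EdgeSet G → ℕ
r G S = n G ∸ k G S

covered : (G : Multigraph) → EdgeSet G → Fin (n G) → Bool
covered G S v = anyFin (m G) (λ e → (e ∈ₑ S) ∧
  ((proj₁ (ends G e) == v) ∨ (proj₂ (ends G e) == v)))

-- k_cov(B): number of connected components of (V(B),B), i.e. the number
-- of components of (V,B) consisting of covered vertices
kcov : (G : Multigraph) → EdgeSet G → ℕ
kcov G B = countFin (n G) (λ v → covered G B v ∧ isRep G B v)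

vdisjoint : (G : Multigraph) → EdgeSet G → EdgeSet G → Bool
vdisjoint G A B = not (anyFin (n G) (λ v → covered G A v ∧ covered G B v))

module _ {c ℓ} (R : CommutativeRing c ℓ) where
  open CommutativeRing R using (Carrier; _+_; _*_; -_; 0#; 1#)

  pow : Carrier → ℕ → Carrier
  pow x zero    = 1#
  pow x (suc j) = x * pow x j

  sumL : List Carrier → Carrier
  sumL = foldr _+_ 0#

  prodFin : (j : ℕ) → (Fin j → Carrier) → Carrier
  prodFin zero    f = 1#
  prodFin (suc j) f = f zero * prodFin j (λ i → f (suc i))

  prodE : (G : Multigraph) → (Fin (m G) → Carrier) → Carrier
  prodE G u = prodFin (m G) u

  prodIn : (G : Multigraph) → EdgeSet G → (Fin (m G) → Carrier) → Carrier
  prodIn G S t = prodFin (m G) (λ e → if e ∈ₑ S then t e else 1#)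

  prodOut : (G : Multigraph) → EdgeSet G → (Fin (m G) → Carrier) → Carrier
  prodOut G S u = prodFin (m G) (λ e → if e ∈ₑ S then 1# else u e)

  oneMinus : Carrier → Carrier
  oneMinus ω = 1# + (- ω)

  -- Ch(G,ω,ū) = Σ_{S⊆E} (1-ω)^{|S|-r(S)} ∏_{e∈E∖S} u_e
  -- (|S| ≥ r(S) always, so truncated subtraction is exact)
  Ch : (G : Multigraph) → Carrier → (Fin (m G) → Carrier) → Carrier
  Ch G ω u = sumL (map (λ S → pow (oneMinus ω) (size G S ∸ r G S) * prodOut G S u)
                       (subsets (m G)))

  -- ξ_lab(G,x,y,z,t̄) = Σ_{(A,B), V(A)∩V(B)=∅}
  --     x^{k(A∪B)} (∏_{e∈A∪B} y t_e) (z/(xy))^{k_cov(B)}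
  -- written as the polynomial it is:
  --     x^{k(A∪B)-k_cov(B)} y^{|A∪B|-k_cov(B)} z^{k_cov(B)} ∏_{e∈A∪B} t_e
  -- (k(A∪B) ≥ k_cov(B) and |A∪B| ≥ k_cov(B) always; z^0 = 1 gives 0^0 = 1)
  ξlab : (G : Multigraph) → Carrier → Carrier → Carrier → (Fin (m G) → Carrier) → Carrier
  ξlab G x y z t =
    sumL (concatMap (λ A → concatMap (λ B →
            if vdisjoint G A B
            then (pow x (k G (A ∪ₑ B) ∸ kcov G B) * pow y (size G (A ∪ₑ B) ∸ kcov G B)
                   * pow z (kcov G B) * prodIn G (A ∪ₑ B) t) ∷ []
            else [])
          (subsets (m G))) (subsets (m G)))

module Submission where

-- Write x = 1-ω (invertible, with inverse ι) and t_e = x·u_e⁻¹.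
--
-- At z = 0 every pair (A,B) of ξ_lab with B ≠ ∅ contributes 0, since an edge
-- of B forces k_cov(B) ≥ 1; the pair (A,∅) contributes x^{k(A)} y^{|A|} ∏_{e∈A} t_e.
-- Therefore, with y = 1,
--   ∏_E u · ι^{|V|} · ξ_lab(G,x,1,0,t)
--     = Σ_A ι^{|V|} x^{k(A)} x^{|A|} · (∏_E u)(∏_A u⁻¹)
--     = Σ_A x^{|A|-r(A)} ∏_{E∖A} u  =  Ch(G,ω,u).
-- The exponent identity ι^{|V|} x^{k(A)+|A|} = x^{|A|-(|V|-k(A))} is valid because
-- k(A) ≤ |V| ≤ |A| + k(A); the second inequality is the rank bound r(A) ≤ |A|.
--
-- The rank bound follows by
-- induction on the edges: one more edge creates at most one new
-- non-representative.

open import Defs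
open import Data.Nat as ℕ using (ℕ; zero; suc; _≤_; _<_; z≤n; s≤s; _∸_)
import Data.Nat.Properties as ℕₚ
open import Data.Bool using (Bool; true; false; _∧_; _∨_; not; if_then_else_)
open import Data.Bool.Properties using (∧-conicalˡ; ∧-conicalʳ; ∧-zeroʳ; not-injective)
open import Data.Fin using (Fin; zero; suc; toℕ; _≟_)
import Data.Fin.Properties as Finₚ
open import Data.Vec using (Vec; []; _∷_; lookup; replicate)
open import Data.Vec.Properties using (lookup-replicate)
open import Data.List using (List; []; _∷_; _++_; map; concatMap)
open import Data.List.Properties using (map-++; map-∘)
open import Data.Product using (_×_; _,_; proj₁; proj₂; Σ)
open import Data.Sum using (_⊎_; inj₁; inj₂)
open import Data.Empty using (⊥; ⊥-elim)
open import Relation.Nullary using (¬_; yes; no)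
open import Relation.Nullary.Decidable using (⌊_⌋)
open import Relation.Binary.Definitions using (tri<; tri≈; tri>)
open import Relation.Binary.PropositionalEquality using (_≡_; refl; sym; trans; cong; cong₂; subst)
open import Algebra.Bundles using (CommutativeRing)
import Algebra.Solver.CommutativeMonoid as CommMonoidSolver
import Algebra.Properties.CommutativeSemigroup as CommSemigroupProperties
import Relation.Binary.Reasoning.Setoid as SetoidReasoning

∨-introˡ : ∀ a b → a ≡ true → (a ∨ b) ≡ true
∨-introˡ true b _ = refl

∨-introʳ : ∀ a b → b ≡ true → (a ∨ b) ≡ true
∨-introʳ true  b _ = refl
∨-introʳ false b p = p

∨-elim : ∀ a b → (a ∨ b) ≡ true → a ≡ true ⊎ b ≡ true
∨-elim true  b _ = inj₁ refl
∨-elim false b p = inj₂ p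

∧-intro : ∀ {a b} → a ≡ true → b ≡ true → (a ∧ b) ≡ true
∧-intro refl refl = refl

bool-ext : ∀ {a b : Bool} → (a ≡ true → b ≡ true) → (b ≡ true → a ≡ true) → a ≡ b
bool-ext {true}  {true}  _ _ = refl
bool-ext {true}  {false} f _ = sym (f refl)
bool-ext {false} {true}  _ g = g refl
bool-ext {false} {false} _ _ = refl

==-refl : ∀ {j} (a : Fin j) → (a == a) ≡ true
==-refl a with a ≟ a
... | yes _  = refl
... | no a≢a = ⊥-elim (a≢a refl)

==-sound : ∀ {j} (a b : Fin j) → (a == b) ≡ true → a ≡ b
==-sound a b p with a ≟ b
... | yes a≡b = a≡b

anyFin-intro : ∀ j (f : Fin j → Bool) i → f i ≡ true → anyFin j f ≡ true
anyFin-intro (suc j) f zero    p = ∨-introˡ (f zero) _ p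
anyFin-intro (suc j) f (suc i) p = ∨-introʳ (f zero) _ (anyFin-intro j (λ i → f (suc i)) i p)

anyFin-elim : ∀ j (f : Fin j → Bool) → anyFin j f ≡ true → Σ (Fin j) λ i → f i ≡ true
anyFin-elim (suc j) f p with ∨-elim (f zero) _ p
... | inj₁ f0 = zero , f0
... | inj₂ fs with anyFin-elim j (λ i → f (suc i)) fs
...   | i , fi = suc i , fi

anyFin-cong : ∀ j (f g : Fin j → Bool) → (∀ i → f i ≡ g i) → anyFin j f ≡ anyFin j g
anyFin-cong zero    f g f≗g = refl
anyFin-cong (suc j) f g f≗g = cong₂ _∨_ (f≗g zero) (anyFin-cong j _ _ (λ i → f≗g (suc i)))

anyFin-false : ∀ j (f : Fin j → Bool) → (∀ i → f i ≡ false) → anyFin j f ≡ false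
anyFin-false zero    f never = refl
anyFin-false (suc j) f never rewrite never zero = anyFin-false j _ (λ i → never (suc i))

allFin-intro : ∀ j (f : Fin j → Bool) → (∀ i → f i ≡ true) → allFin j f ≡ true
allFin-intro j f always = cong not (anyFin-false j _ (λ i → cong not (always i)))

allFin-elim : ∀ j (f : Fin j → Bool) → allFin j f ≡ true → ∀ i → f i ≡ true
allFin-elim j f p i with f i in fi
... | true  = refl
... | false with () ← trans (sym (anyFin-intro j (λ i → not (f i)) i (cong not fi))) (not-injective p)

allFin-counterexample : ∀ j (f : Fin j → Bool) → allFin j f ≡ false → Σ (Fin j) λ i → f i ≡ false
allFin-counterexample j f p with anyFin-elim j (λ i → not (f i)) (not-injective p)
... | i , ¬fi = i , not-injective ¬fi

countFin-cong : ∀ j (f g : Fin j → Bool) → (∀ i → f i ≡ g i) → countFin j f ≡ countFin j g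
countFin-cong zero    f g f≗g = refl
countFin-cong (suc j) f g f≗g =
  cong₂ ℕ._+_ (cong (λ b → if b then 1 else 0) (f≗g zero)) (countFin-cong j _ _ (λ i → f≗g (suc i)))

countFin-none : ∀ j (f : Fin j → Bool) → (∀ i → f i ≡ false) → countFin j f ≡ 0
countFin-none zero    f never = refl
countFin-none (suc j) f never rewrite never zero = countFin-none j _ (λ i → never (suc i))

countFin-≤ : ∀ j (f : Fin j → Bool) → countFin j f ≤ j
countFin-≤ zero    f = z≤n
countFin-≤ (suc j) f with f zero
... | true  = s≤s (countFin-≤ j _)
... | false = ℕₚ.m≤n⇒m≤1+n (countFin-≤ j _)

countFin-pos : ∀ j (f : Fin j → Bool) i → f i ≡ true → 1 ≤ countFin j f
countFin-pos (suc j) f zero    fi rewrite fi = s≤s z≤n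
countFin-pos (suc j) f (suc i) fi with f zero
... | true  = s≤s z≤n
... | false = countFin-pos j _ i fi

countFin-mono : ∀ j (f g : Fin j → Bool) → (∀ i → f i ≡ true → g i ≡ true) → countFin j f ≤ countFin j g
countFin-mono zero    f g f⇒g = z≤n
countFin-mono (suc j) f g f⇒g with f zero in f0 | g zero in g0
... | true  | true  = s≤s (countFin-mono j _ _ (λ i → f⇒g (suc i)))
... | false | true  = ℕₚ.m≤n⇒m≤1+n (countFin-mono j _ _ (λ i → f⇒g (suc i)))
... | false | false = countFin-mono j _ _ (λ i → f⇒g (suc i))
... | true  | false with () ← trans (sym (f⇒g zero f0)) g0

countFin-strict : ∀ j (f g : Fin j → Bool) → (∀ i → f i ≡ true → g i ≡ true) →
  (∀ i → g i ≡ f i) ⊎ countFin j f < countFin j g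
countFin-strict zero    f g f⇒g = inj₁ (λ ())
countFin-strict (suc j) f g f⇒g with f zero in f0 | g zero in g0
  | countFin-strict j (λ i → f (suc i)) (λ i → g (suc i)) (λ i → f⇒g (suc i))
... | true  | false | _        with () ← trans (sym (f⇒g zero f0)) g0
... | false | true  | _        = inj₂ (s≤s (countFin-mono j _ _ (λ i → f⇒g (suc i))))
... | true  | true  | inj₂ lt  = inj₂ (s≤s lt)
... | false | false | inj₂ lt  = inj₂ lt
... | true  | true  | inj₁ agr = inj₁ λ { zero → trans g0 (sym f0) ; (suc i) → agr i }
... | false | false | inj₁ agr = inj₁ λ { zero → trans g0 (sym f0) ; (suc i) → agr i }

countFin-split : ∀ j (f g : Fin j → Bool) →
  countFin j f ≤ countFin j g ℕ.+ countFin j (λ i → f i ∧ not (g i))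
countFin-split zero    f g = z≤n
countFin-split (suc j) f g with f zero | g zero
... | true  | true  = s≤s (countFin-split j _ _)
... | true  | false = ℕₚ.≤-trans (s≤s (countFin-split j _ _)) (ℕₚ.≤-reflexive (sym (ℕₚ.+-suc _ _)))
... | false | true  = ℕₚ.m≤n⇒m≤1+n (countFin-split j _ _)
... | false | false = countFin-split j _ _

countFin-unique : ∀ j (f : Fin j → Bool) → (∀ a b → f a ≡ true → f b ≡ true → a ≡ b) → countFin j f ≤ 1
countFin-unique zero    f unique = z≤n
countFin-unique (suc j) f unique with f zero in f0
... | true  = ℕₚ.≤-reflexive (cong suc (countFin-none j _ others))
  where
  others : ∀ i → f (suc i) ≡ false
  others i with f (suc i) in fi
  ... | false = refl
  ... | true with () ← unique zero (suc i) f0 fi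
... | false = countFin-unique j _ (λ a b fa fb → Finₚ.suc-injective (unique (suc a) (suc b) fa fb))

countFin-complement : ∀ j (f : Fin j → Bool) → countFin j f ℕ.+ countFin j (λ i → not (f i)) ≡ j
countFin-complement zero    f = refl
countFin-complement (suc j) f with f zero
... | true  = cong suc (countFin-complement j _)
... | false = trans (ℕₚ.+-suc _ _) (cong suc (countFin-complement j _))

least-witness : ∀ j (f : Fin j → Bool) i → f i ≡ true →
  Σ (Fin j) λ a → f a ≡ true × (∀ b → toℕ b < toℕ a → f b ≡ false)
least-witness (suc j) f i fi with f zero in f0
... | true = zero , f0 , λ b ()
least-witness (suc j) f zero    fi | false with () ← trans (sym fi) f0
least-witness (suc j) f (suc i) fi | false with least-witness j (λ a → f (suc a)) i fi
... | a , fa , below = suc a , fa , λ { zero _ → f0 ; (suc b) (s≤s b<a) → below b b<a }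

Joins : ∀ {j} → Fin j × Fin j → Fin j → Fin j → Set
Joins ends a b = (proj₁ ends ≡ a × proj₂ ends ≡ b) ⊎ (proj₂ ends ≡ a × proj₁ ends ≡ b)

Step : (G : Multigraph) → EdgeSet G → Fin (n G) → Fin (n G) → Set
Step G S a b = Σ (Fin (m G)) λ e → lookup S e ≡ true × Joins (ends G e) a b

data Walk (G : Multigraph) (S : EdgeSet G) (x : Fin (n G)) : Fin (n G) → Set where
  here : Walk G S x x
  snoc : ∀ {a b} → Walk G S x a → Step G S a b → Walk G S x b

module _ {G : Multigraph} {S : EdgeSet G} where

  walk-++ : ∀ {x y z} → Walk G S x y → Walk G S y z → Walk G S x z
  walk-++ w here          = w
  walk-++ w (snoc w′ st) = snoc (walk-++ w w′) st

  step-sym : ∀ {a b} → Step G S a b → Step G S b a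
  step-sym (e , e∈S , inj₁ (p , q)) = e , e∈S , inj₂ (q , p)
  step-sym (e , e∈S , inj₂ (p , q)) = e , e∈S , inj₁ (q , p)

  walk-cons : ∀ {a x y} → Step G S a x → Walk G S x y → Walk G S a y
  walk-cons st here         = snoc here st
  walk-cons st (snoc w st′) = snoc (walk-cons st w) st′

  walk-reverse : ∀ {x y} → Walk G S x y → Walk G S y x
  walk-reverse here        = here
  walk-reverse (snoc w st) = walk-cons (step-sym st) (walk-reverse w)

  reach-sound : ∀ j x y → reach G S j x y ≡ true → Walk G S x y
  reach-sound zero x y p rewrite ==-sound x y p = here
  reach-sound (suc j) x y p with ∨-elim (reach G S j x y) _ p
  ... | inj₁ shorter = reach-sound j x y shorter
  ... | inj₂ lastStep with anyFin-elim (m G) _ lastStep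
  ... | e , p′ with ∨-elim (reach G S j x (proj₁ (ends G e)) ∧ (proj₂ (ends G e) == y)) _ (∧-conicalʳ _ _ p′)
  ... | inj₁ fwd = snoc (reach-sound j x _ (∧-conicalˡ _ _ fwd))
                        (e , ∧-conicalˡ _ _ p′ , inj₁ (refl , ==-sound _ _ (∧-conicalʳ _ _ fwd)))
  ... | inj₂ bwd = snoc (reach-sound j x _ (∧-conicalˡ _ _ bwd))
                        (e , ∧-conicalˡ _ _ p′ , inj₂ (refl , ==-sound _ _ (∧-conicalʳ _ _ bwd)))

  reach-weaken : ∀ i j x y → reach G S j x y ≡ true → reach G S (i ℕ.+ j) x y ≡ true
  reach-weaken zero    j x y p = p
  reach-weaken (suc i) j x y p = ∨-introˡ _ _ (reach-weaken i j x y p)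

  walk-reach : ∀ {x y} → Walk G S x y → Σ ℕ λ j → reach G S j x y ≡ true
  walk-reach {x} here = 0 , ==-refl x
  walk-reach {x} {y} (snoc {a = a} w (e , e∈S , joins)) with walk-reach w
  ... | j , x↝a = suc j , ∨-introʳ (reach G S j x y) _ (anyFin-intro (m G) _ e (∧-intro e∈S (lastStep joins)))
    where
    lastStep : Joins (ends G e) a y →
      ((reach G S j x (proj₁ (ends G e)) ∧ (proj₂ (ends G e) == y)) ∨
       (reach G S j x (proj₂ (ends G e)) ∧ (proj₁ (ends G e) == y))) ≡ true
    lastStep (inj₁ (refl , refl)) = ∨-introˡ _ _ (∧-intro x↝a (==-refl _))
    lastStep (inj₂ (refl , refl)) =
      ∨-introʳ (reach G S j x (proj₁ (ends G e)) ∧ (proj₂ (ends G e) == y)) _ (∧-intro x↝a (==-refl _))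

  -- Walks can be shortened to at most |V| edges: the sets reachable from x in
  -- j steps grow strictly until they stabilise, and they have at most |V|
  -- elements, so they are stable from step |V| on.
  module Shortening (x : Fin (n G)) where

    Reach : ℕ → Fin (n G) → Bool
    Reach j = reach G S j x

    Stable : ℕ → Set
    Stable j = ∀ v → Reach (suc j) v ≡ Reach j v

    stable-suc : ∀ j → Stable j → Stable (suc j)
    stable-suc j st v = cong₂ _∨_ (st v) (anyFin-cong (m G) _ _ λ e →
      cong (lookup S e ∧_) (cong₂ _∨_ (cong (_∧ _) (st (proj₁ (ends G e))))
                                      (cong (_∧ _) (st (proj₂ (ends G e))))))

    stable-from : ∀ i j → Stable j → ∀ v → Reach (i ℕ.+ j) v ≡ Reach j v
    stable-from zero    j st v = refl
    stable-from (suc i) j st v = trans (stable-at i v) (stable-from i j st v)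
      where
      stable-at : ∀ i → Stable (i ℕ.+ j)
      stable-at zero    = st
      stable-at (suc i) = stable-suc (i ℕ.+ j) (stable-at i)

    grows-or-stable : ∀ j → suc j ≤ countFin (n G) (Reach j) ⊎ Stable j
    grows-or-stable zero = inj₁ (countFin-pos (n G) (Reach 0) x (==-refl x))
    grows-or-stable (suc j) with grows-or-stable j
    ... | inj₂ st = inj₂ (stable-suc j st)
    ... | inj₁ big with countFin-strict (n G) (Reach j) (Reach (suc j)) (λ v → ∨-introˡ _ _)
    ...   | inj₁ st = inj₂ (stable-suc j st)
    ...   | inj₂ lt = inj₁ (ℕₚ.≤-trans (s≤s big) lt)

    stable-at-|V| : Stable (n G)
    stable-at-|V| with grows-or-stable (n G)
    ... | inj₂ st  = st
    ... | inj₁ big = ⊥-elim (ℕₚ.<-irrefl refl (ℕₚ.≤-trans big (countFin-≤ (n G) _)))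

    shorten : ∀ j y → Reach j y ≡ true → Reach (n G) y ≡ true
    shorten j y p with ℕₚ.≤-total j (n G)
    ... | inj₁ j≤|V| with ℕₚ.m≤n⇒∃[o]m+o≡n j≤|V|
    ...   | d , j+d≡|V| = subst (λ i → Reach i y ≡ true) (trans (ℕₚ.+-comm d j) j+d≡|V|) (reach-weaken d j x y p)
    shorten j y p | inj₂ |V|≤j with ℕₚ.m≤n⇒∃[o]m+o≡n |V|≤j
    ...   | d , |V|+d≡j =
      trans (sym (stable-from d (n G) stable-at-|V| y))
            (subst (λ i → Reach i y ≡ true) (sym (trans (ℕₚ.+-comm d (n G)) |V|+d≡j)) p)

  connected-complete : ∀ {x y} → Walk G S x y → connected G S x y ≡ true
  connected-complete {x} {y} w with walk-reach w
  ... | j , p = Shortening.shorten x j y p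

  connected-sound : ∀ x y → connected G S x y ≡ true → Walk G S x y
  connected-sound x y = reach-sound (n G) x y

  rep-intro : ∀ v → (∀ w → toℕ w < toℕ v → ¬ Walk G S w v) → isRep G S v ≡ true
  rep-intro v minimal = allFin-intro (n G) _ noSmaller
    where
    noSmaller : ∀ w → not (⌊ toℕ w ℕ.<? toℕ v ⌋ ∧ connected G S w v) ≡ true
    noSmaller w with toℕ w ℕ.<? toℕ v
    ... | no _ = refl
    ... | yes w<v with connected G S w v in w~v
    ...   | false = refl
    ...   | true  = ⊥-elim (minimal w w<v (connected-sound w v w~v))

  rep-elim : ∀ v → isRep G S v ≡ true → ∀ w → toℕ w < toℕ v → ¬ Walk G S w v
  rep-elim v rep w w<v walk with allFin-elim (n G) _ rep w
  ... | noSmaller with toℕ w ℕ.<? toℕ v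
  ...   | no w≮v = w≮v w<v
  ...   | yes _ rewrite connected-complete walk with noSmaller
  ...     | ()

  nonrep-elim : ∀ v → isRep G S v ≡ false → Σ (Fin (n G)) λ w → toℕ w < toℕ v × Walk G S w v
  nonrep-elim v nonrep with allFin-counterexample (n G) _ nonrep
  ... | w , smaller with toℕ w ℕ.<? toℕ v
  ...   | yes w<v = w , w<v , connected-sound w v (∧-conicalʳ true _ (not-injective smaller))
  ...   | no _ with smaller
  ...     | ()

-- The rank bound r(S) ≤ |S|.  We count the non-representatives, of which there
-- are |V| - k(S), and add the edges one at a time.

graph : (nv ne : ℕ) → (Fin ne → Fin nv × Fin nv) → Multigraph
graph nv ne en = record { n = nv ; m = ne ; ends = en }

nonReps : (G : Multigraph) → EdgeSet G → ℕ
nonReps G S = countFin (n G) (λ v → not (isRep G S v))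

module AddEdge (nv ne : ℕ) (en : Fin (suc ne) → Fin nv × Fin nv) (b : Bool) (S₀ : Vec Bool ne) where

  G : Multigraph
  G = graph nv (suc ne) en

  S : EdgeSet G
  S = b ∷ S₀

  G₀ : Multigraph
  G₀ = graph nv ne (λ i → en (suc i))

  p q : Fin nv
  p = proj₁ (en zero)
  q = proj₂ (en zero)

  Walk₀ : Fin nv → Fin nv → Set
  Walk₀ = Walk G₀ S₀

  -- A walk of G crosses the new edge (at least once) if it is not a walk of G₀.
  Crossing : Fin nv → Fin nv → Set
  Crossing x y = (Walk₀ x p × Walk₀ q y) ⊎ (Walk₀ x q × Walk₀ p y)

  Decomposed : Fin nv → Fin nv → Set
  Decomposed x y = Walk₀ x y ⊎ (b ≡ true × Crossing x y)

  lift : ∀ {x y} → Walk₀ x y → Walk G S x y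
  lift here                   = here
  lift (snoc w (i , i∈S , j)) = snoc (lift w) (suc i , i∈S , j)

  toEnd : ∀ {x a} → Decomposed x a → (a ≡ p ⊎ a ≡ q) → Walk₀ x p ⊎ Walk₀ x q
  toEnd (inj₁ w) (inj₁ refl)                  = inj₁ w
  toEnd (inj₁ w) (inj₂ refl)                  = inj₂ w
  toEnd (inj₂ (_ , inj₁ (x↝p , _))) _ = inj₁ x↝p
  toEnd (inj₂ (_ , inj₂ (x↝q , _))) _ = inj₂ x↝q

  decompose : ∀ {x y} → Walk G S x y → Decomposed x y
  decompose here = inj₁ here
  decompose (snoc w (suc i , i∈S , j)) with decompose w
  ... | inj₁ w₀                      = inj₁ (snoc w₀ (i , i∈S , j))
  ... | inj₂ (b≡t , inj₁ (u , w₀)) = inj₂ (b≡t , inj₁ (u , snoc w₀ (i , i∈S , j)))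
  ... | inj₂ (b≡t , inj₂ (u , w₀)) = inj₂ (b≡t , inj₂ (u , snoc w₀ (i , i∈S , j)))
  decompose (snoc w (zero , b≡t , inj₁ (refl , refl))) with toEnd (decompose w) (inj₁ refl)
  ... | inj₁ x↝p = inj₂ (b≡t , inj₁ (x↝p , here))
  ... | inj₂ x↝q = inj₁ x↝q
  decompose (snoc w (zero , b≡t , inj₂ (refl , refl))) with toEnd (decompose w) (inj₂ refl)
  ... | inj₁ x↝p = inj₁ x↝p
  ... | inj₂ x↝q = inj₂ (b≡t , inj₂ (x↝q , here))

  rep-lift : ∀ v → isRep G S v ≡ true → isRep G₀ S₀ v ≡ true
  rep-lift v rep = rep-intro v (λ w w<v walk → rep-elim v rep w w<v (lift walk))

  rep-unchanged : b ≡ false → ∀ v → isRep G S v ≡ isRep G₀ S₀ v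
  rep-unchanged b≡f v = bool-ext (rep-lift v) λ rep₀ → rep-intro v λ w w<v walk →
    absurd rep₀ w w<v (decompose walk)
    where
    absurd : isRep G₀ S₀ v ≡ true → ∀ w → toℕ w < toℕ v → Decomposed w v → ⊥
    absurd rep₀ w w<v (inj₁ walk₀) = rep-elim v rep₀ w w<v walk₀
    absurd rep₀ w w<v (inj₂ (b≡t , _)) with () ← trans (sym b≡f) b≡t

  Bridged : Fin nv → Set
  Bridged v = Σ (Fin nv) λ w → toℕ w < toℕ v × Crossing w v

  lost-rep-bridged : ∀ v → isRep G₀ S₀ v ≡ true → isRep G S v ≡ false → Bridged v
  lost-rep-bridged v rep₀ nonrep with nonrep-elim v nonrep
  ... | w , w<v , walk with decompose walk
  ...   | inj₁ walk₀         = ⊥-elim (rep-elim v rep₀ w w<v walk₀)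
  ...   | inj₂ (_ , crossing) = w , w<v , crossing

  -- Two bridged vertices v₁ < v₂ are joined in G₀ (possibly via the smaller
  -- vertex w₁), so v₂ is not a representative of G₀.
  bridged-below-rep : ∀ v₁ v₂ → isRep G₀ S₀ v₂ ≡ true → Bridged v₁ → Bridged v₂ → toℕ v₁ < toℕ v₂ → ⊥
  bridged-below-rep v₁ v₂ rep₂ (w₁ , w₁<v₁ , c₁) (_ , _ , c₂) v₁<v₂ with c₁ | c₂
  ... | inj₁ (_ , q↝v₁) | inj₁ (_ , q↝v₂) = rep-elim v₂ rep₂ v₁ v₁<v₂ (walk-++ (walk-reverse q↝v₁) q↝v₂)
  ... | inj₂ (_ , p↝v₁) | inj₂ (_ , p↝v₂) = rep-elim v₂ rep₂ v₁ v₁<v₂ (walk-++ (walk-reverse p↝v₁) p↝v₂)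
  ... | inj₁ (w₁↝p , _) | inj₂ (_ , p↝v₂) = rep-elim v₂ rep₂ w₁ (ℕₚ.<-trans w₁<v₁ v₁<v₂) (walk-++ w₁↝p p↝v₂)
  ... | inj₂ (w₁↝q , _) | inj₁ (_ , q↝v₂) = rep-elim v₂ rep₂ w₁ (ℕₚ.<-trans w₁<v₁ v₁<v₂) (walk-++ w₁↝q q↝v₂)

  lostRep : Fin nv → Bool
  lostRep v = not (isRep G S v) ∧ not (not (isRep G₀ S₀ v))

  lostRep-elim : ∀ v → lostRep v ≡ true → isRep G₀ S₀ v ≡ true × isRep G S v ≡ false
  lostRep-elim v lost = not-injective (not-injective (∧-conicalʳ _ _ lost)) , not-injective (∧-conicalˡ _ _ lost)

  lostRep-unique : ∀ v₁ v₂ → lostRep v₁ ≡ true → lostRep v₂ ≡ true → v₁ ≡ v₂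
  lostRep-unique v₁ v₂ lost₁ lost₂ with lostRep-elim v₁ lost₁ | lostRep-elim v₂ lost₂
  ... | rep₁ , nonrep₁ | rep₂ , nonrep₂ with ℕₚ.<-cmp (toℕ v₁) (toℕ v₂)
  ...   | tri< v₁<v₂ _ _ = ⊥-elim (bridged-below-rep v₁ v₂ rep₂ (lost-rep-bridged v₁ rep₁ nonrep₁) (lost-rep-bridged v₂ rep₂ nonrep₂) v₁<v₂)
  ...   | tri≈ _ v₁≡v₂ _ = Finₚ.toℕ-injective v₁≡v₂
  ...   | tri> _ _ v₂<v₁ = ⊥-elim (bridged-below-rep v₂ v₁ rep₁ (lost-rep-bridged v₂ rep₂ nonrep₂) (lost-rep-bridged v₁ rep₁ nonrep₁) v₂<v₁)

  nonReps-step : nonReps G S ≤ suc (nonReps G₀ S₀)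
  nonReps-step = ℕₚ.≤-trans (countFin-split nv _ _)
    (ℕₚ.≤-trans (ℕₚ.+-monoʳ-≤ (nonReps G₀ S₀) (countFin-unique nv lostRep lostRep-unique))
                (ℕₚ.≤-reflexive (ℕₚ.+-comm _ 1)))

nonReps≤size : ∀ nv ne en (S : Vec Bool ne) → nonReps (graph nv ne en) S ≤ size (graph nv ne en) S
nonReps≤size nv zero en [] = ℕₚ.≤-reflexive (countFin-none nv _ λ v → cong not (rep-intro v (noWalk v)))
  where
  noWalk : ∀ v w → toℕ w < toℕ v → ¬ Walk (graph nv zero en) [] w v
  noWalk v .v v<v here              = ℕₚ.<-irrefl refl v<v
  noWalk v w  _   (snoc _ (() , _))
nonReps≤size nv (suc ne) en (false ∷ S₀) =
  subst (_≤ size (AddEdge.G₀ nv ne en false S₀) S₀)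
        (countFin-cong nv _ _ (λ v → cong not (sym (AddEdge.rep-unchanged nv ne en false S₀ refl v))))
        (nonReps≤size nv ne (λ i → en (suc i)) S₀)
nonReps≤size nv (suc ne) en (true ∷ S₀) =
  ℕₚ.≤-trans (AddEdge.nonReps-step nv ne en true S₀) (s≤s (nonReps≤size nv ne (λ i → en (suc i)) S₀))

-- |V| ≤ |S| + k(S), i.e. r(S) ≤ |S|.
rank-bound : ∀ (G : Multigraph) (S : EdgeSet G) → n G ≤ size G S ℕ.+ k G S
rank-bound G S = subst (_≤ size G S ℕ.+ k G S)
  (trans (ℕₚ.+-comm (nonReps G S) (k G S)) (countFin-complement (n G) (isRep G S)))
  (ℕₚ.+-monoˡ-≤ (k G S) (nonReps≤size (n G) (m G) (ends G) S))

module _ {G : Multigraph} {B : EdgeSet G} where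

  covered-intro : ∀ e v → lookup B e ≡ true → (proj₁ (ends G e) ≡ v ⊎ proj₂ (ends G e) ≡ v) →
    covered G B v ≡ true
  covered-intro e v e∈B (inj₁ refl) =
    anyFin-intro (m G) _ e (∧-intro e∈B (∨-introˡ _ (proj₂ (ends G e) == v) (==-refl v)))
  covered-intro e v e∈B (inj₂ refl) =
    anyFin-intro (m G) _ e (∧-intro e∈B (∨-introʳ (proj₁ (ends G e) == v) _ (==-refl v)))

  covered-walk : ∀ {a v} → covered G B a ≡ true → Walk G B a v → covered G B v ≡ true
  covered-walk cov here                                  = cov
  covered-walk cov (snoc _ (e , e∈B , inj₁ (_ , e₂≡v))) = covered-intro e _ e∈B (inj₂ e₂≡v)
  covered-walk cov (snoc _ (e , e∈B , inj₂ (_ , e₁≡v))) = covered-intro e _ e∈B (inj₁ e₁≡v)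

  -- If B contains an edge e, the least vertex of the component of an endpoint
  -- of e is a covered representative, so k_cov(B) ≥ 1.
  kcov-pos : ∀ e → lookup B e ≡ true → 1 ≤ kcov G B
  kcov-pos e e∈B with least-witness (n G) (connected G B a) a (connected-complete {G = G} {S = B} here)
    where a = proj₁ (ends G e)
  ... | r , a~r , below = countFin-pos (n G) _ r (∧-intro r-covered r-rep)
    where
    a = proj₁ (ends G e)
    a↝r : Walk G B a r
    a↝r = connected-sound a r a~r
    r-covered : covered G B r ≡ true
    r-covered = covered-walk (covered-intro e a e∈B (inj₁ refl)) a↝r
    r-rep : isRep G B r ≡ true
    r-rep = rep-intro r noSmaller
      where
      noSmaller : ∀ w → toℕ w < toℕ r → ¬ Walk G B w r
      noSmaller w w<r w↝r
        with () ← trans (sym (below w w<r)) (connected-complete (walk-++ a↝r (walk-reverse w↝r)))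

∅ : (G : Multigraph) → EdgeSet G
∅ G = replicate (m G) false

module _ (G : Multigraph) where

  covered-∅ : ∀ v → covered G (∅ G) v ≡ false
  covered-∅ v = anyFin-false (m G) _ λ e →
    cong (_∧ ((proj₁ (ends G e) == v) ∨ (proj₂ (ends G e) == v))) (lookup-replicate e false)

  kcov-∅ : kcov G (∅ G) ≡ 0
  kcov-∅ = countFin-none (n G) _ λ v → cong (_∧ isRep G (∅ G) v) (covered-∅ v)

  vdisjoint-∅ : ∀ A → vdisjoint G A (∅ G) ≡ true
  vdisjoint-∅ A = cong not (anyFin-false (n G) _ λ v →
    trans (cong (covered G A v ∧_) (covered-∅ v)) (∧-zeroʳ (covered G A v)))

∪-∅ : ∀ {j} (A : Vec Bool j) → (A ∪ₑ replicate j false) ≡ A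
∪-∅ []          = refl
∪-∅ (true ∷ A)  = cong (true ∷_) (∪-∅ A)
∪-∅ (false ∷ A) = cong (false ∷_) (∪-∅ A)

module RingFacts {c ℓ} (R : CommutativeRing c ℓ) where
  open CommutativeRing R hiding (zero) renaming (refl to ≈-refl; sym to ≈-sym; trans to ≈-trans)
  open SetoidReasoning setoid
  open CommMonoidSolver *-commutativeMonoid using (solve; _⊕_; _⊜_)
  open CommSemigroupProperties *-commutativeSemigroup using (interchange)

  sumL-++ : ∀ xs ys → sumL R (xs ++ ys) ≈ sumL R xs + sumL R ys
  sumL-++ []       ys = ≈-sym (+-identityˡ _)
  sumL-++ (x ∷ xs) ys = ≈-trans (+-congˡ (sumL-++ xs ys)) (≈-sym (+-assoc _ _ _))

  sumL-concatMap : ∀ {a} {A : Set a} (g : A → List Carrier) xs →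
    sumL R (concatMap g xs) ≈ sumL R (map (λ z → sumL R (g z)) xs)
  sumL-concatMap g []       = ≈-refl
  sumL-concatMap g (z ∷ xs) = ≈-trans (sumL-++ (g z) (concatMap g xs)) (+-congˡ (sumL-concatMap g xs))

  sumL-cong : ∀ {a} {A : Set a} {f g : A → Carrier} → (∀ z → f z ≈ g z) → ∀ xs →
    sumL R (map f xs) ≈ sumL R (map g xs)
  sumL-cong f≈g []       = ≈-refl
  sumL-cong f≈g (z ∷ xs) = +-cong (f≈g z) (sumL-cong f≈g xs)

  sumL-zero : ∀ {a} {A : Set a} (f : A → Carrier) → (∀ z → f z ≈ 0#) → ∀ xs → sumL R (map f xs) ≈ 0#
  sumL-zero f f≈0 []       = ≈-refl
  sumL-zero f f≈0 (z ∷ xs) = ≈-trans (+-cong (f≈0 z) (sumL-zero f f≈0 xs)) (+-identityˡ _)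

  sumL-distribˡ : ∀ {a} {A : Set a} (x : Carrier) (f : A → Carrier) xs →
    x * sumL R (map f xs) ≈ sumL R (map (λ z → x * f z) xs)
  sumL-distribˡ x f []       = zeroʳ x
  sumL-distribˡ x f (z ∷ xs) = ≈-trans (distribˡ x _ _) (+-congˡ (sumL-distribˡ x f xs))

  sum-subsets-at-∅ : ∀ j (h : Vec Bool j → Carrier) → (∀ B e → lookup B e ≡ true → h B ≈ 0#) →
    sumL R (map h (subsets j)) ≈ h (replicate j false)
  sum-subsets-at-∅ zero    h _     = +-identityʳ _
  sum-subsets-at-∅ (suc j) h h≈0 = begin
      sumL R (map h (map (true ∷_) (subsets j) ++ map (false ∷_) (subsets j)))
    ≡⟨ cong (sumL R) (map-++ h (map (true ∷_) (subsets j)) (map (false ∷_) (subsets j))) ⟩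
      sumL R (map h (map (true ∷_) (subsets j)) ++ map h (map (false ∷_) (subsets j)))
    ≈⟨ sumL-++ (map h (map (true ∷_) (subsets j))) (map h (map (false ∷_) (subsets j))) ⟩
      sumL R (map h (map (true ∷_) (subsets j))) + sumL R (map h (map (false ∷_) (subsets j)))
    ≡⟨ cong₂ (λ xs ys → sumL R xs + sumL R ys) (sym (map-∘ (subsets j))) (sym (map-∘ (subsets j))) ⟩
      sumL R (map (λ B → h (true ∷ B)) (subsets j)) + sumL R (map (λ B → h (false ∷ B)) (subsets j))
    ≈⟨ +-cong (sumL-zero _ (λ B → h≈0 (true ∷ B) zero refl) (subsets j))
              (sum-subsets-at-∅ j (λ B → h (false ∷ B)) (λ B e e∈B → h≈0 (false ∷ B) (suc e) e∈B)) ⟩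
      0# + h (false ∷ replicate j false)
    ≈⟨ +-identityˡ _ ⟩
      h (replicate (suc j) false)
    ∎

  pow-1# : ∀ j → pow R 1# j ≈ 1#
  pow-1# zero    = ≈-refl
  pow-1# (suc j) = ≈-trans (*-identityˡ _) (pow-1# j)

  pow-+ : ∀ x a b → pow R x (a ℕ.+ b) ≈ pow R x a * pow R x b
  pow-+ x zero    b = ≈-sym (*-identityˡ _)
  pow-+ x (suc a) b = ≈-trans (*-congˡ (pow-+ x a b)) (≈-sym (*-assoc _ _ _))

  pow-inverse : ∀ x ι → x * ι ≈ 1# → ∀ j → pow R ι j * pow R x j ≈ 1#
  pow-inverse x ι xι≈1 zero    = *-identityˡ _
  pow-inverse x ι xι≈1 (suc j) = begin
      (ι * pow R ι j) * (x * pow R x j)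
    ≈⟨ solve 4 (λ a b c d → (a ⊕ b) ⊕ (c ⊕ d) ⊜ (c ⊕ a) ⊕ (b ⊕ d)) ≈-refl ι (pow R ι j) x (pow R x j) ⟩
      (x * ι) * (pow R ι j * pow R x j)
    ≈⟨ *-cong xι≈1 (pow-inverse x ι xι≈1 j) ⟩
      1# * 1#
    ≈⟨ *-identityˡ 1# ⟩
      1#
    ∎

  pow-cancel : ∀ x ι → x * ι ≈ 1# → ∀ {nv kv s} → kv ≤ nv → nv ≤ s ℕ.+ kv →
    pow R ι nv * pow R x kv * pow R x s ≈ pow R x (s ∸ (nv ∸ kv))
  pow-cancel x ι xι≈1 {nv} {kv} {s} kv≤nv nv≤s+kv with ℕₚ.m≤n⇒∃[o]m+o≡n kv≤nv
  ... | a , refl with ℕₚ.m≤n⇒∃[o]m+o≡n (ℕₚ.+-cancelˡ-≤ kv a s (subst (kv ℕ.+ a ≤_) (ℕₚ.+-comm s kv) nv≤s+kv))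
  ...   | d , refl rewrite ℕₚ.m+n∸m≡n kv a | ℕₚ.m+n∸m≡n a d = begin
      pow R ι (kv ℕ.+ a) * pow R x kv * pow R x (a ℕ.+ d)
    ≈⟨ *-cong (*-congʳ (pow-+ ι kv a)) (pow-+ x a d) ⟩
      (pow R ι kv * pow R ι a) * pow R x kv * (pow R x a * pow R x d)
    ≈⟨ solve 5 (λ ιk ιa xk xa xd → ((ιk ⊕ ιa) ⊕ xk) ⊕ (xa ⊕ xd) ⊜ (ιk ⊕ xk) ⊕ ((ιa ⊕ xa) ⊕ xd))
             ≈-refl (pow R ι kv) (pow R ι a) (pow R x kv) (pow R x a) (pow R x d) ⟩
      (pow R ι kv * pow R x kv) * ((pow R ι a * pow R x a) * pow R x d)
    ≈⟨ *-cong (pow-inverse x ι xι≈1 kv) (*-congʳ (pow-inverse x ι xι≈1 a)) ⟩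
      1# * (1# * pow R x d)
    ≈⟨ ≈-trans (*-identityˡ _) (*-identityˡ _) ⟩
      pow R x d
    ∎

  prodFin-scale : ∀ j (A : Fin j → Bool) x (t : Fin j → Carrier) →
    prodFin R j (λ e → if A e then x * t e else 1#) ≈ pow R x (countFin j A) * prodFin R j (λ e → if A e then t e else 1#)
  prodFin-scale zero    A x t = ≈-sym (*-identityˡ _)
  prodFin-scale (suc j) A x t with A zero
  ... | true  = ≈-trans (*-congˡ (prodFin-scale j _ x _))
                        (interchange x _ _ _)
  ... | false = ≈-trans (*-identityˡ _) (≈-trans (prodFin-scale j _ x _) (*-congˡ (≈-sym (*-identityˡ _))))

  prodFin-complement : ∀ j (A : Fin j → Bool) (u uinv : Fin j → Carrier) → (∀ e → u e * uinv e ≈ 1#) →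
    prodFin R j u * prodFin R j (λ e → if A e then uinv e else 1#) ≈ prodFin R j (λ e → if A e then 1# else u e)
  prodFin-complement zero    A u uinv inv = *-identityˡ _
  prodFin-complement (suc j) A u uinv inv with A zero
  ... | true  = ≈-trans (interchange _ _ _ _) (*-cong (inv zero) (prodFin-complement j _ _ _ (λ e → inv (suc e))))
  ... | false = ≈-trans (interchange _ _ _ _) (*-cong (*-identityʳ _) (prodFin-complement j _ _ _ (λ e → inv (suc e))))

  pow-0#-pos : ∀ j → 1 ≤ j → pow R 0# j ≈ 0#
  pow-0#-pos (suc j) _ = zeroˡ _

  ξlab-at-z=0 : ∀ G x y t → ξlab R G x y 0# t ≈
    sumL R (map (λ A → pow R x (k G A) * pow R y (size G A) * prodIn R G A t) (subsets (m G)))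
  ξlab-at-z=0 G x y t =
    ≈-trans (sumL-concatMap (λ A → concatMap (term A) (subsets (m G))) (subsets (m G)))
            (sumL-cong onlyEmpty (subsets (m G)))
    where
    term : EdgeSet G → EdgeSet G → List Carrier
    term A B = if vdisjoint G A B
               then (pow R x (k G (A ∪ₑ B) ∸ kcov G B) * pow R y (size G (A ∪ₑ B) ∸ kcov G B)
                      * pow R 0# (kcov G B) * prodIn R G (A ∪ₑ B) t) ∷ []
               else []

    vanishes : ∀ A B e → lookup B e ≡ true → sumL R (term A B) ≈ 0#
    vanishes A B e e∈B with vdisjoint G A B
    ... | false = ≈-refl
    ... | true  = ≈-trans (+-identityʳ _)
                          (≈-trans (*-congʳ (*-congˡ (pow-0#-pos (kcov G B) (kcov-pos {G = G} {B = B} e e∈B))))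
                                   (≈-trans (*-congʳ (zeroʳ _)) (zeroˡ _)))

    atEmpty : ∀ A → sumL R (term A (∅ G)) ≈ pow R x (k G A) * pow R y (size G A) * prodIn R G A t
    atEmpty A rewrite vdisjoint-∅ G A | ∪-∅ A | kcov-∅ G = ≈-trans (+-identityʳ _) (*-congʳ (*-identityʳ _))

    onlyEmpty : ∀ A → sumL R (concatMap (term A) (subsets (m G))) ≈
                      pow R x (k G A) * pow R y (size G A) * prodIn R G A t
    onlyEmpty A = ≈-trans (sumL-concatMap (term A) (subsets (m G)))
                          (≈-trans (sum-subsets-at-∅ (m G) (λ B → sumL R (term A B)) (vanishes A))
                                   (atEmpty A))

  Ch-term-identity : ∀ G {x ι} → x * ι ≈ 1# → ∀ u uinv → (∀ e → u e * uinv e ≈ 1#) → ∀ A →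
    (prodE R G u * pow R ι (n G)) * (pow R x (k G A) * pow R 1# (size G A) * prodIn R G A (λ e → x * uinv e))
    ≈ pow R x (size G A ∸ r G A) * prodOut R G A u
  Ch-term-identity G {x} {ι} xι≈1 u uinv inv A = begin
      (P * pow R ι (n G)) * (pow R x (k G A) * pow R 1# (size G A) * prodIn R G A (λ e → x * uinv e))
    ≈⟨ *-congˡ (*-cong (≈-trans (*-congˡ (pow-1# (size G A))) (*-identityʳ _))
                       (prodFin-scale (m G) (lookup A) x uinv)) ⟩
      (P * pow R ι (n G)) * (pow R x (k G A) * (pow R x (size G A) * Q))
    ≈⟨ solve 5 (λ p ιn xk xs q → (p ⊕ ιn) ⊕ (xk ⊕ (xs ⊕ q)) ⊜ ((ιn ⊕ xk) ⊕ xs) ⊕ (p ⊕ q))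
             ≈-refl P (pow R ι (n G)) (pow R x (k G A)) (pow R x (size G A)) Q ⟩
      (pow R ι (n G) * pow R x (k G A) * pow R x (size G A)) * (P * Q)
    ≈⟨ *-cong (pow-cancel x ι xι≈1 (countFin-≤ (n G) (isRep G A)) (rank-bound G A))
              (prodFin-complement (m G) (lookup A) u uinv inv) ⟩
      pow R x (size G A ∸ r G A) * prodOut R G A u
    ∎
    where
    P = prodE R G u
    Q = prodIn R G A uinv

corollary3 : ∀ {c ℓ} (R : CommutativeRing c ℓ) (G : Multigraph) →
    let open CommutativeRing R in
    (ω : Carrier) (u : Fin (m G) → Carrier)
    (ι : Carrier) → oneMinus R ω * ι ≈ 1# →
    (uinv : Fin (m G) → Carrier) → (∀ e → u e * uinv e ≈ 1#) →
    Ch R G ω u ≈ prodE R G u * pow R ι (n G)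
                 * ξlab R G (oneMinus R ω) 1# 0# (λ e → oneMinus R ω * uinv e)
corollary3 R G ω u ι xι≈1 uinv inv = ≈-sym (begin
    C * ξlab R G x 1# 0# t
  ≈⟨ *-congˡ (ξlab-at-z=0 G x 1# t) ⟩
    C * sumL R (map f (subsets (m G)))
  ≈⟨ sumL-distribˡ C f (subsets (m G)) ⟩
    sumL R (map (λ A → C * f A) (subsets (m G)))
  ≈⟨ sumL-cong (Ch-term-identity G xι≈1 u uinv inv) (subsets (m G)) ⟩
    Ch R G ω u
  ∎)
  where
  open CommutativeRing R using (Carrier; _*_; 0#; 1#; *-congˡ; setoid) renaming (sym to ≈-sym)
  open SetoidReasoning setoid
  open RingFacts R
  x : Carrier
  x = oneMinus R ω
  t : Fin (m G) → Carrier
  t e = x * uinv e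
  C : Carrier
  C = prodE R G u * pow R ι (n G)
  f : EdgeSet G → Carrier
  f A = pow R x (k G A) * pow R 1# (size G A) * prodIn R G A t
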